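{- Let $\lesssim$ be a plausible preorder on $\mathcal{T}$ and $E(\cdot|\cdot)$ the conditional expectation naturally induced by it. Let $X$ be a random quantity and $C,D$ events. If $E(X|C.D)=0$, then $E(X.C|D)=0$.
   Context: Random quantities: $\mathcal{T}$ is a unital associative commutative algebra over $\mathbb{R}$; reals $r$ are identified with $r\mathbf{1}$; products are written $X.Y$. Events: idempotents $A$ ($A.A=A$). Plausible preorder: a relation $\lesssim$ on $\mathcal{T}$ with (i) $0\lesssim A$ for every event $A$; (ii) $0\lesssim X$ and $0\lesssim Y$ imply $0\lesssim X+Y$; (iii) $0\lesssim X$ and real $q\ge0$ imply $0\lesssim qX$; (iv) $X\lesssim Y$ iff $0\lesssim Y-X$. Strict part: $X\lnsim Y$ iff $X\lesssim Y$ and not $Y\lesssim X$. Conditional preorder: $X\lesssim_C Y$ iff $X.C\lesssim Y.C$; strict part $\lnsim_C$. Expectation induced by a plausible preorder: $E(X)$ is the real $x$ if $-\epsilon\lnsim X-x\lnsim\epsilon$ for all reals $\epsilon>0$; it is $+\infty$ if $y\lnsim X$ for all reals $y$; it is $-\infty$ if $X\lnsim y$ for all reals $y$; it is undefined otherwise. Conditional expectation: $E(X|C)$ is the expectation induced by $\lesssim_C$. -}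

module Defs where

open import Level using (0ℓ) renaming (suc to lsuc)
open import Algebra.Bundles using (CommutativeRing)
open import Algebra.Morphism.Structures using (module RingMorphisms)
open import Data.Product using (Σ; ∃; _×_)
open import Data.Sum using (_⊎_)
open import Relation.Nullary using (¬_)

-- The real numbers, axiomatised as a complete ordered field
-- (any two such are isomorphic, so quantifying over them is
-- quantifying over ℝ).

record RealNumbers : Set₁ where
  field
    cring : CommutativeRing 0ℓ 0ℓ
  open CommutativeRing cring public hiding (ring)
  field
    _<_        : Carrier → Carrier → Set
    <-resp-≈   : ∀ {x x' y y'} → x ≈ x' → y ≈ y' → x < y → x' < y'
    <-irrefl   : ∀ x → ¬ (x < x)
    <-trans    : ∀ {x y z} → x < y → y < z → x < z
    <-trichot  : ∀ x y → x < y ⊎ x ≈ y ⊎ y < x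
    +-mono-<   : ∀ {x y} z → x < y → (x + z) < (y + z)
    *-pos      : ∀ {x y} → 0# < x → 0# < y → 0# < (x * y)
    0<1        : 0# < 1#
    inverse    : ∀ x → ¬ (x ≈ 0#) → ∃ λ y → (x * y) ≈ 1#

  _≤_ : Carrier → Carrier → Set
  x ≤ y = x < y ⊎ x ≈ y

  field
    complete : (P : Carrier → Set) → (∃ λ x → P x) →
               (∃ λ b → ∀ x → P x → x ≤ b) →
               ∃ λ s → (∀ x → P x → x ≤ s) ×
                       (∀ b → (∀ x → P x → x ≤ b) → s ≤ b)

-- Random quantities: a unital associative commutative ℝ-algebra 𝒯,
-- presented as a commutative ring with a unital ring homomorphism
-- ι : ℝ → 𝒯 (the real r is identified with r·1 = ι r; scalar
-- multiplication is q X = ι q * X).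

record RAlgebra (R : RealNumbers) : Set₁ where
  field
    cring : CommutativeRing 0ℓ 0ℓ
  open CommutativeRing cring public hiding (ring)
  private module R = RealNumbers R
  field
    ι     : R.Carrier → Carrier
    ι-hom : RingMorphisms.IsRingHomomorphism
              (CommutativeRing.rawRing R.cring) (CommutativeRing.rawRing cring) ι

  _·_ : R.Carrier → Carrier → Carrier
  q · X = ι q * X

  IsEvent : Carrier → Set
  IsEvent A = (A * A) ≈ A

module _ (R : RealNumbers) (T : RAlgebra R) where
  private
    module R = RealNumbers R
  open RAlgebra T

  record PlausiblePreorder : Set₁ where
    field
      _≲_      : Carrier → Carrier → Set
      ≲-resp-≈ : ∀ {X X' Y Y'} → X ≈ X' → Y ≈ Y' → X ≲ Y → X' ≲ Y'
      event-nonneg : ∀ A → IsEvent A → 0# ≲ A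
      nonneg-+ : ∀ {X Y} → 0# ≲ X → 0# ≲ Y → 0# ≲ (X + Y)
      nonneg-· : ∀ {X} (q : R.Carrier) → 0# ≲ X → R.0# R.≤ q → 0# ≲ (q · X)
      ≲⇒diff : ∀ {X Y} → X ≲ Y → 0# ≲ (Y - X)
      diff⇒≲ : ∀ {X Y} → 0# ≲ (Y - X) → X ≲ Y

  Strict : (Carrier → Carrier → Set) → Carrier → Carrier → Set
  Strict _≼_ X Y = (X ≼ Y) × ¬ (Y ≼ X)

  Conditional : (Carrier → Carrier → Set) → Carrier → Carrier → Carrier → Set
  Conditional _≼_ C X Y = (X * C) ≼ (Y * C)

  ExpectationIs : (Carrier → Carrier → Set) → Carrier → R.Carrier → Set
  ExpectationIs _≼_ X x =
    ∀ (ε : R.Carrier) → R.0# R.< ε →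
      Strict _≼_ (ι (R.- ε)) (X - ι x) × Strict _≼_ (X - ι x) (ι ε)

  CondExpectationIs : PlausiblePreorder → Carrier → Carrier → R.Carrier → Set
  CondExpectationIs P X C x =
    ExpectationIs (Conditional (PlausiblePreorder._≲_ P) C) X x

-- Proof idea: since C.D ≤ D as events, D - C.D is itself an event and hence
-- plausibly nonnegative, so ε.(C.D) ≲ ε.D and -ε.D ≲ -ε.(C.D) for ε > 0.
-- The hypothesis says -ε.(C.D) ⋨ X.(C.D) ⋨ ε.(C.D), and X.(C.D) = (X.C).D,
-- so chaining gives -ε.D ⋨ (X.C).D ⋨ ε.D, which is E(X.C | D) = 0.
module Submission where

open import Defs
open import Data.Product using (_,_; proj₁; proj₂)
open import Data.Sum using (inj₁)
open import Relation.Binary.Core using (Rel)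
open import Algebra.Bundles using (CommutativeRing)
open import Algebra.Morphism.Structures using (module RingMorphisms)
import Algebra.Properties.Ring as RingProperties
import Algebra.Properties.Group as GroupProperties
import Relation.Binary.Reasoning.Setoid as SetoidReasoning

module EventProperties (R : RealNumbers) (T : RAlgebra R) where
  open RAlgebra T
  open RingProperties (CommutativeRing.ring cring) using (x[y-z]≈xy-xz; [y-z]x≈yx-zx; -0#≈0#)
  open SetoidReasoning setoid

  x-0#≈x : ∀ x → x - 0# ≈ x
  x-0#≈x x = trans (+-congˡ -0#≈0#) (+-identityʳ x)

  *-isEvent : ∀ {C D} → IsEvent C → IsEvent D → IsEvent (C * D)
  *-isEvent {C} {D} C-event D-event = begin
    (C * D) * (C * D) ≈⟨ *-assoc C D (C * D) ⟩
    C * (D * (C * D)) ≈⟨ *-congˡ (*-congˡ (*-comm C D)) ⟩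
    C * (D * (D * C)) ≈⟨ *-congˡ (sym (*-assoc D D C)) ⟩
    C * ((D * D) * C) ≈⟨ *-congˡ (*-congʳ D-event) ⟩
    C * (D * C)       ≈⟨ *-congˡ (*-comm D C) ⟩
    C * (C * D)       ≈⟨ sym (*-assoc C C D) ⟩
    (C * C) * D       ≈⟨ *-congʳ C-event ⟩
    C * D             ∎

  difference-isEvent : ∀ {D F} → IsEvent D → IsEvent F → F * D ≈ F → IsEvent (D - F)
  difference-isEvent {D} {F} D-event F-event F⊆D = begin
    (D - F) * (D - F)                 ≈⟨ [y-z]x≈yx-zx (D - F) D F ⟩
    D * (D - F) - F * (D - F)         ≈⟨ +-cong (x[y-z]≈xy-xz D D F) (-‿cong (x[y-z]≈xy-xz F D F)) ⟩
    (D * D - D * F) - (F * D - F * F) ≈⟨ +-cong (+-cong D-event (-‿cong (trans (*-comm D F) F⊆D)))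
                                                (-‿cong (+-cong F⊆D (-‿cong F-event))) ⟩
    (D - F) - (F - F)                 ≈⟨ +-congˡ (-‿cong (-‿inverseʳ F)) ⟩
    (D - F) - 0#                      ≈⟨ x-0#≈x (D - F) ⟩
    D - F                             ∎

module PlausiblePreorderProperties (R : RealNumbers) (T : RAlgebra R) (P : PlausiblePreorder R T) where
  private module R = RealNumbers R
  open RAlgebra T
  open PlausiblePreorder P
  open EventProperties R T
  open RingMorphisms.IsRingHomomorphism ι-hom using (-‿homo)
  open RingProperties (CommutativeRing.ring cring) using (x[y-z]≈xy-xz; -‿distribˡ-*; -‿involutive)
  open GroupProperties +-group using (\\-leftDividesʳ)

  infix 4 _⋨_
  _⋨_ : Rel Carrier _
  _⋨_ = Strict R T _≲_

  ≲-trans : ∀ {X Y Z} → X ≲ Y → Y ≲ Z → X ≲ Z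
  ≲-trans {X} {Y} {Z} X≲Y Y≲Z =
    diff⇒≲ (≲-resp-≈ refl telescope (nonneg-+ (≲⇒diff Y≲Z) (≲⇒diff X≲Y)))
    where
    telescope : (Z - Y) + (Y - X) ≈ Z - X
    telescope = trans (+-assoc Z (- Y) (Y - X)) (+-congˡ (\\-leftDividesʳ Y (- X)))

  ≲-⋨-trans : ∀ {X Y Z} → X ≲ Y → Y ⋨ Z → X ⋨ Z
  ≲-⋨-trans X≲Y (Y≲Z , Z≴Y) = ≲-trans X≲Y Y≲Z , λ Z≲X → Z≴Y (≲-trans Z≲X X≲Y)

  ⋨-≲-trans : ∀ {X Y Z} → X ⋨ Y → Y ≲ Z → X ⋨ Z
  ⋨-≲-trans (X≲Y , Y≴X) Y≲Z = ≲-trans X≲Y Y≲Z , λ Z≲X → Y≴X (≲-trans Y≲Z Z≲X)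

  ⋨-resp-≈ : ∀ {X X' Y Y'} → X ≈ X' → Y ≈ Y' → X ⋨ Y → X' ⋨ Y'
  ⋨-resp-≈ X≈X' Y≈Y' (X≲Y , Y≴X) =
    ≲-resp-≈ X≈X' Y≈Y' X≲Y , λ Y'≲X' → Y≴X (≲-resp-≈ (sym Y≈Y') (sym X≈X') Y'≲X')

  ·-mono-≲ : ∀ {q X Y} → R.0# R.≤ q → X ≲ Y → (q · X) ≲ (q · Y)
  ·-mono-≲ {q} {X} {Y} 0≤q X≲Y =
    diff⇒≲ (≲-resp-≈ refl (x[y-z]≈xy-xz (ι q) Y X) (nonneg-· q (≲⇒diff X≲Y) 0≤q))

  -‿antimono-≲ : ∀ {X Y} → X ≲ Y → (- Y) ≲ (- X)
  -‿antimono-≲ {X} {Y} X≲Y = diff⇒≲ (≲-resp-≈ refl Y-X≈-X--Y (≲⇒diff X≲Y))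
    where
    Y-X≈-X--Y : Y - X ≈ - X - - Y
    Y-X≈-X--Y = trans (+-comm Y (- X)) (+-congˡ (sym (-‿involutive Y)))

  -‿distribˡ-· : ∀ q X → (R.- q) · X ≈ - (q · X)
  -‿distribˡ-· q X = trans (*-congʳ (-‿homo q)) (sym (-‿distribˡ-* (ι q) X))

  -·-antimono-≲ : ∀ {q X Y} → R.0# R.≤ q → X ≲ Y → ((R.- q) · Y) ≲ ((R.- q) · X)
  -·-antimono-≲ {q} {X} {Y} 0≤q X≲Y =
    ≲-resp-≈ (sym (-‿distribˡ-· q Y)) (sym (-‿distribˡ-· q X)) (-‿antimono-≲ (·-mono-≲ 0≤q X≲Y))

  *-event-≲ : ∀ {C D} → IsEvent C → IsEvent D → (C * D) ≲ D
  *-event-≲ {C} {D} C-event D-event =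
    diff⇒≲ (event-nonneg (D - C * D) (difference-isEvent D-event (*-isEvent C-event D-event) CD⊆D))
    where
    CD⊆D : (C * D) * D ≈ C * D
    CD⊆D = trans (*-assoc C D D) (*-congˡ D-event)

mainTheorem3 : (R : RealNumbers) (T : RAlgebra R) (P : PlausiblePreorder R T)
    (X C D : RAlgebra.Carrier T) →
    RAlgebra.IsEvent T C → RAlgebra.IsEvent T D →
    CondExpectationIs R T P X (RAlgebra._*_ T C D) (RealNumbers.0# R) →
    CondExpectationIs R T P (RAlgebra._*_ T X C) D (RealNumbers.0# R)
mainTheorem3 R T P X C D C-event D-event E[X∣CD]≡0 ε 0<ε =
    ≲-⋨-trans (-·-antimono-≲ (inj₁ 0<ε) CD≲D) (⋨-resp-≈ refl shift lower)
  , ⋨-≲-trans (⋨-resp-≈ shift refl upper) (·-mono-≲ (inj₁ 0<ε) CD≲D)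
  where
  module ℝ = RealNumbers R
  open RAlgebra T
  open PlausiblePreorder P
  open EventProperties R T using (x-0#≈x)
  open PlausiblePreorderProperties R T P
  open RingMorphisms.IsRingHomomorphism ι-hom using (0#-homo)
  open SetoidReasoning setoid

  lower : (ι (ℝ.- ε) * (C * D)) ⋨ ((X - ι ℝ.0#) * (C * D))
  lower = proj₁ (E[X∣CD]≡0 ε 0<ε)

  upper : ((X - ι ℝ.0#) * (C * D)) ⋨ (ι ε * (C * D))
  upper = proj₂ (E[X∣CD]≡0 ε 0<ε)

  CD≲D : (C * D) ≲ D
  CD≲D = *-event-≲ C-event D-event

  centred : ∀ Y → Y - ι ℝ.0# ≈ Y
  centred Y = trans (+-congˡ (-‿cong 0#-homo)) (x-0#≈x Y)

  shift : (X - ι ℝ.0#) * (C * D) ≈ (X * C - ι ℝ.0#) * D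
  shift = begin
    (X - ι ℝ.0#) * (C * D) ≈⟨ *-congʳ (centred X) ⟩
    X * (C * D)            ≈⟨ sym (*-assoc X C D) ⟩
    (X * C) * D            ≈⟨ sym (*-congʳ (centred (X * C))) ⟩
    (X * C - ι ℝ.0#) * D   ∎
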